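{- Let $q$ be a prime power and let $g\colon GF(q)^2\to GF(q)$ be any function. Let $l_\infty=\langle (0,0,0,1),(0,0,1,0)\rangle$ and consider the set of lines of $PG(3,q)$ $$\mathcal S_g = l_{\infty} \cup \{ \langle (0,1,x,y), (1,0,-y,g(x,y)) \rangle \ | \ x,y \in GF(q) \}.$$ Then $\mathcal S_g$ is a spread of $PG(3,q)$ (equivalently, a symplectic spread with respect to the alternating form $((x_0,x_1,x_2,x_3),(y_0,y_1,y_2,y_3))=x_0y_3-x_3y_0-x_1y_2+y_1x_2$) if and only if for all $a,b\in GF(q)$ the map $x \mapsto g(x,ax-b) + a^2x$ is a permutation of $GF(q)$.
   Context: $PG(3,q)$ is the projective space of dimension 3 over $GF(q)$, whose points are the nonzero vectors of $GF(q)^4$ modulo scalars; $\langle u,v\rangle$ denotes the line spanned by the points $u,v$. A spread of $PG(3,q)$ is a set of lines partitioning the points of $PG(3,q)$. A spread is symplectic if every line of it is totally isotropic with respect to a fixed non-degenerate alternating form, i.e. the form vanishes on any two points of the same line. All lines of $\mathcal S_g$ are totally isotropic with respect to the form given in the claim. -}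

module Defs where

open import Level using (0ℓ)
open import Data.Nat using (ℕ)
open import Data.Fin using (Fin)
open import Data.Product using (Σ; ∃; ∃!; _×_; _,_)
open import Data.Maybe using (Maybe; just; nothing)
open import Relation.Nullary using (¬_)
open import Relation.Binary.PropositionalEquality using (_≡_)
open import Algebra.Structures using (IsCommutativeRing)
open import Function.Bundles using (_↔_)
import Function.Definitions as FD

-- A finite field (with propositional equality).  Every finite field is GF(q)
-- for a prime power q = size, and every GF(q) is of this form.
record FiniteField : Set₁ where
  infixl 7 _*_
  infixl 6 _+_
  infix  8 -_
  field
    Carrier : Set
    _+_ _*_ : Carrier → Carrier → Carrier
    -_ : Carrier → Carrier
    0# 1# : Carrier
    isCommutativeRing : IsCommutativeRing _≡_ _+_ _*_ -_ 0# 1#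
    0≢1 : ¬ (0# ≡ 1#)
    inverse : ∀ x → ¬ (x ≡ 0#) → ∃ λ y → x * y ≡ 1#
    size : ℕ
    enumeration : Carrier ↔ Fin size

module ProjectiveSpace (𝔽 : FiniteField) where
  open FiniteField 𝔽

  infixl 6 _-_
  _-_ : Carrier → Carrier → Carrier
  x - y = x + (- y)

  record V4 : Set where
    constructor ⟨_,_,_,_⟩
    field
      c0 c1 c2 c3 : Carrier
  open V4 public

  NonZero : V4 → Set
  NonZero v = ¬ (c0 v ≡ 0# × c1 v ≡ 0# × c2 v ≡ 0# × c3 v ≡ 0#)

  lin : Carrier → V4 → Carrier → V4 → V4
  lin a u b v = ⟨ a * c0 u + b * c0 v , a * c1 u + b * c1 v
                , a * c2 u + b * c2 v , a * c3 u + b * c3 v ⟩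

  Line : Set
  Line = V4 × V4

  OnLine : V4 → Line → Set
  OnLine p (u , v) = ∃ λ a → ∃ λ b → p ≡ lin a u b v

  IsSpread : {I : Set} → (I → Line) → Set
  IsSpread {I} L = ∀ p → NonZero p → ∃! _≡_ (λ i → OnLine p (L i))

  form : V4 → V4 → Carrier
  form x y = (c0 x * c3 y - c3 x * c0 y) - c1 x * c2 y + c1 y * c2 x

  TotallyIsotropic : Line → Set
  TotallyIsotropic l = ∀ p r → OnLine p l → OnLine r l → form p r ≡ 0#

  IsSymplecticSpread : {I : Set} → (I → Line) → Set
  IsSymplecticSpread {I} L = IsSpread L × (∀ i → TotallyIsotropic (L i))

  S : (Carrier → Carrier → Carrier) → Maybe (Carrier × Carrier) → Line
  S g nothing = (⟨ 0# , 0# , 0# , 1# ⟩ , ⟨ 0# , 0# , 1# , 0# ⟩)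
  S g (just (x , y)) = (⟨ 0# , 1# , x , y ⟩ , ⟨ 1# , 0# , - y , g x y ⟩)

  IsPermutation : (Carrier → Carrier) → Set
  IsPermutation f = FD.Bijective _≡_ _≡_ f

  PermCondition : (Carrier → Carrier → Carrier) → Set
  PermCondition g = ∀ a b → IsPermutation (λ x → g x (a * x - b) + (a * a) * x)

-- A nonzero point with p₀ = p₁ = 0 lies only on l∞, and (0,1,b,e) only on the line with parameters
-- (b,e).  The point (1,a,b,e) lies on the line with parameters (x,y) iff y = ax − b and
-- g(x, ax − b) + a²x = e + ab, so it lies on exactly one line of S_g iff that equation has exactly one
-- solution x.  Incidence is invariant under nonzero scalars and every nonzero point is a multiple of a
-- point of one of these three shapes, so S_g is a spread iff every x ↦ g(x, ax − b) + a²x is a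
-- bijection.  The lines are totally isotropic because the form restricted to ⟨u,v⟩ is
-- (αδ − βγ)·form(u,v), and form(u,v) = 0 for the two spanning points of each line.

module Submission where

open import Defs
open import Level using (0ℓ)
open import Algebra.Bundles using (CommutativeRing)
open import Algebra.Solver.Ring.AlmostCommutativeRing
  using (fromCommutativeRing; _-Raw-AlmostCommutative⟶_)
open import Data.Empty using (⊥-elim)
import Data.Fin.Properties as Fin
open import Data.Integer.Base as ℤ using (ℤ; +_; -[1+_]; 0ℤ; 1ℤ)
import Data.Integer.Properties as ℤ
open import Data.Maybe.Base as Maybe using (Maybe; just; nothing)
open import Data.Maybe.Properties using (just-injective)
open import Data.Nat.Base as ℕ using (zero; suc)
import Data.Nat.Properties as ℕ
open import Data.Product.Properties using (,-injectiveˡ)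
open import Data.Sign.Base as Sign using (Sign)
open import Function.Base using (_∘_)
open import Function.Bundles using (_⇔_; Equivalence; mk⇔)
open import Function.Construct.Composition using (_⇔-∘_)
open import Function.Definitions using (Injective; Surjective; Bijective)
open import Function.Properties.Equivalence using () renaming (sym to ⇔-sym)
open import Function.Properties.Inverse using (↔⇒↣)
open import Relation.Binary.Consequences using (dec⇒weaklyDec)
open import Relation.Binary.Definitions using (DecidableEquality)
import Relation.Binary.PropositionalEquality as ≡
open import Relation.Nullary using (yes; no)
open import Relation.Nullary.Decidable using (via-injection)

-- The ring solver for an arbitrary commutative ring, with integer coefficients through the canonical
-- morphism ℤ → R (cf. Algebra.Solver.Ring.NaturalCoefficients).  The solver compares coefficients by
-- computation, so the elements of an abstract field cannot serve as their own coefficients.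
module IntegerCoefficients {c ℓ} (R : CommutativeRing c ℓ) where
  open CommutativeRing R
  open import Algebra.Properties.Ring ring
    using (-0#≈0#; -‿involutive; -‿anti-homo-+; -‿distribˡ-*; -‿distribʳ-*)
  open import Algebra.Properties.Semiring.Mult.TCOptimised semiring
    using (_×_; 1+×; ×-homo-+; ×1-homo-*)
  open import Relation.Binary.Reasoning.Setoid setoid

  signed : Sign → Carrier → Carrier
  signed Sign.+ x = x
  signed Sign.- x = - x

  ⟦_⟧ℤ : ℤ → Carrier
  ⟦ i ⟧ℤ = signed (ℤ.sign i) (ℤ.∣ i ∣ × 1#)

  signed-cong : ∀ s {x y} → x ≈ y → signed s x ≈ signed s y
  signed-cong Sign.+ x≈y = x≈y
  signed-cong Sign.- x≈y = -‿cong x≈y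

  signed-* : ∀ s t x y → signed (s Sign.* t) (x * y) ≈ signed s x * signed t y
  signed-* Sign.+ Sign.+ x y = refl
  signed-* Sign.+ Sign.- x y = -‿distribʳ-* x y
  signed-* Sign.- Sign.+ x y = -‿distribˡ-* x y
  signed-* Sign.- Sign.- x y = begin
    x * y           ≈⟨ -‿involutive (x * y) ⟨
    - - (x * y)     ≈⟨ -‿cong (-‿distribˡ-* x y) ⟩
    - (- x * y)     ≈⟨ -‿distribʳ-* (- x) y ⟩
    - x * - y       ∎

  ⟦◃⟧ : ∀ s n → ⟦ s ℤ.◃ n ⟧ℤ ≈ signed s (n × 1#)
  ⟦◃⟧ Sign.+ zero    = refl
  ⟦◃⟧ Sign.- zero    = sym -0#≈0#
  ⟦◃⟧ Sign.+ (suc n) = refl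
  ⟦◃⟧ Sign.- (suc n) = refl

  +-cancelˡ-minus : ∀ a x y → (a + x) - (a + y) ≈ x - y
  +-cancelˡ-minus a x y = begin
    (a + x) + - (a + y)    ≈⟨ +-cong (+-comm a x) (-‿anti-homo-+ a y) ⟩
    (x + a) + (- y + - a)  ≈⟨ +-congˡ (+-comm (- y) (- a)) ⟩
    (x + a) + (- a + - y)  ≈⟨ +-assoc x a _ ⟩
    x + (a + (- a + - y))  ≈⟨ +-congˡ (+-assoc a (- a) (- y)) ⟨
    x + ((a + - a) + - y)  ≈⟨ +-congˡ (+-congʳ (-‿inverseʳ a)) ⟩
    x + (0# + - y)         ≈⟨ +-congˡ (+-identityˡ (- y)) ⟩
    x - y                  ∎

  ⟦⊖⟧ : ∀ m n → ⟦ m ℤ.⊖ n ⟧ℤ ≈ m × 1# - n × 1#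
  ⟦⊖⟧ m zero rewrite ℤ.⊖-≥ (ℕ.z≤n {m}) = begin
    m × 1#       ≈⟨ +-identityʳ (m × 1#) ⟨
    m × 1# + 0#  ≈⟨ +-congˡ -0#≈0# ⟨
    m × 1# - 0#  ∎
  ⟦⊖⟧ zero    (suc n) = sym (+-identityˡ _)
  ⟦⊖⟧ (suc m) (suc n) rewrite ℤ.[1+m]⊖[1+n]≡m⊖n m n = begin
    ⟦ m ℤ.⊖ n ⟧ℤ                        ≈⟨ ⟦⊖⟧ m n ⟩
    m × 1# - n × 1#                     ≈⟨ +-cancelˡ-minus 1# (m × 1#) (n × 1#) ⟨
    (1# + m × 1#) - (1# + n × 1#)       ≈⟨ +-cong (1+× m 1#) (-‿cong (1+× n 1#)) ⟨
    suc m × 1# - suc n × 1#             ∎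

  ⟦⟧-+ : ∀ i j → ⟦ i ℤ.+ j ⟧ℤ ≈ ⟦ i ⟧ℤ + ⟦ j ⟧ℤ
  ⟦⟧-+ (+ m)    (+ n)    = ×-homo-+ 1# m n
  ⟦⟧-+ (+ m)    -[1+ n ] = ⟦⊖⟧ m (suc n)
  ⟦⟧-+ -[1+ m ] (+ n)    = trans (⟦⊖⟧ n (suc m)) (+-comm _ _)
  ⟦⟧-+ -[1+ m ] -[1+ n ] = begin
    - (suc (suc (m ℕ.+ n)) × 1#)       ≡⟨ ≡.cong (λ k → - (suc k × 1#)) (ℕ.+-suc m n) ⟨
    - ((suc m ℕ.+ suc n) × 1#)         ≈⟨ -‿cong (×-homo-+ 1# (suc m) (suc n)) ⟩
    - (suc m × 1# + suc n × 1#)        ≈⟨ -‿anti-homo-+ _ _ ⟩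
    - (suc n × 1#) + - (suc m × 1#)    ≈⟨ +-comm _ _ ⟩
    - (suc m × 1#) + - (suc n × 1#)    ∎

  ⟦⟧-* : ∀ i j → ⟦ i ℤ.* j ⟧ℤ ≈ ⟦ i ⟧ℤ * ⟦ j ⟧ℤ
  ⟦⟧-* i j = begin
    ⟦ (s Sign.* t) ℤ.◃ (m ℕ.* n) ⟧ℤ        ≈⟨ ⟦◃⟧ (s Sign.* t) (m ℕ.* n) ⟩
    signed (s Sign.* t) ((m ℕ.* n) × 1#)  ≈⟨ signed-cong (s Sign.* t) (×1-homo-* m n) ⟩
    signed (s Sign.* t) (m × 1# * n × 1#) ≈⟨ signed-* s t _ _ ⟩
    ⟦ i ⟧ℤ * ⟦ j ⟧ℤ                       ∎
    where s = ℤ.sign i; t = ℤ.sign j; m = ℤ.∣ i ∣; n = ℤ.∣ j ∣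

  ⟦⟧-‿ : ∀ i → ⟦ ℤ.- i ⟧ℤ ≈ - ⟦ i ⟧ℤ
  ⟦⟧-‿ (+ zero)  = sym -0#≈0#
  ⟦⟧-‿ (+ suc n) = refl
  ⟦⟧-‿ -[1+ n ]  = sym (-‿involutive _)

  almostCommutativeRing = fromCommutativeRing R

  homomorphism : ℤ.+-*-rawRing -Raw-AlmostCommutative⟶ almostCommutativeRing
  homomorphism = record
    { ⟦_⟧    = ⟦_⟧ℤ
    ; +-homo = ⟦⟧-+
    ; *-homo = ⟦⟧-*
    ; -‿homo = ⟦⟧-‿
    ; 0-homo = refl
    ; 1-homo = refl
    }

  open import Algebra.Solver.Ring ℤ.+-*-rawRing almostCommutativeRing homomorphism
    (λ i j → Maybe.map (λ i≡j → reflexive (≡.cong ⟦_⟧ℤ i≡j)) (dec⇒weaklyDec ℤ._≟_ i j))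
    public

open import Data.Product using (_×_; ∃; ∃!; _,_; proj₁; proj₂)
open ≡ using (_≡_; refl; sym; trans; cong; cong₂; subst)
open ≡.≡-Reasoning

∃!-cong : ∀ {A : Set} {P Q : A → Set} → (∀ a → P a ⇔ Q a) → ∃! _≡_ P ⇔ ∃! _≡_ Q
∃!-cong P⇔Q = mk⇔ (transport P⇔Q) (transport (λ a → ⇔-sym (P⇔Q a)))
  where
  transport : ∀ {P Q : _ → Set} → (∀ a → P a ⇔ Q a) → ∃! _≡_ P → ∃! _≡_ Q
  transport P⇔Q (a , Pa , unique) = a , to (P⇔Q a) Pa , λ Qb → unique (from (P⇔Q _) Qb)
    where open Equivalence

∃!-≡ : ∀ {A : Set} (a : A) → ∃! _≡_ (_≡ a)
∃!-≡ a = a , refl , sym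

∃!-image : ∀ {A B : Set} {R : A → Set} (k : A → B) → Injective _≡_ _≡_ k →
           ∃! _≡_ (λ b → ∃ λ a → b ≡ k a × R a) ⇔ ∃! _≡_ R
∃!-image {R = R} k k-injective = mk⇔ to from
  where
  to : ∃! _≡_ (λ b → ∃ λ a → b ≡ k a × R a) → ∃! _≡_ R
  to (_ , (a , refl , Ra) , unique) = a , Ra , λ Ra′ → k-injective (unique (_ , refl , Ra′))

  from : ∃! _≡_ R → ∃! _≡_ (λ b → ∃ λ a → b ≡ k a × R a)
  from (a , Ra , unique) = k a , (a , refl , Ra) , λ { (a′ , refl , Ra′) → cong k (unique Ra′) }

bijective⇔∃!-preimage : ∀ {A B : Set} (f : A → B) →
                        Bijective _≡_ _≡_ f ⇔ (∀ b → ∃! _≡_ λ a → f a ≡ b)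
bijective⇔∃!-preimage f = mk⇔ to from
  where
  to : Bijective _≡_ _≡_ f → ∀ b → ∃! _≡_ λ a → f a ≡ b
  to (injective , surjective) b with surjective b
  ... | a , fa≡b = a , fa≡b refl , λ fa′≡b → injective (trans (fa≡b refl) (sym fa′≡b))

  from : (∀ b → ∃! _≡_ λ a → f a ≡ b) → Bijective _≡_ _≡_ f
  from unique-preimage = injective , surjective
    where
    injective : Injective _≡_ _≡_ f
    injective {a} {a′} fa≡fa′ with unique-preimage (f a′)
    ... | _ , _ , unique = trans (sym (unique fa≡fa′)) (unique refl)

    surjective : Surjective _≡_ _≡_ f
    surjective b with unique-preimage b
    ... | a , fa≡b , _ = a , λ { refl → fa≡b }

module _ (𝔽 : FiniteField) where
  open FiniteField 𝔽
  open ProjectiveSpace 𝔽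

  commutativeRing : CommutativeRing 0ℓ 0ℓ
  commutativeRing = record { isCommutativeRing = isCommutativeRing }

  open CommutativeRing commutativeRing
    using (*-assoc; *-comm; *-identityˡ; *-identityʳ; zeroʳ)
  open IntegerCoefficients commutativeRing using (solve; _:=_; _:+_; _:*_; _:-_; :-_; con)

  _≟_ : DecidableEquality Carrier
  _≟_ = via-injection (↔⇒↣ enumeration) Fin._≟_

  *-cancel-inverse : ∀ {c d} → c * d ≡ 1# → ∀ x → c * (d * x) ≡ x
  *-cancel-inverse {c} {d} c*d≡1 x = begin
    c * (d * x)  ≡⟨ *-assoc c d x ⟨
    (c * d) * x  ≡⟨ cong (_* x) c*d≡1 ⟩
    1# * x       ≡⟨ *-identityˡ x ⟩
    x            ∎

  x*0+y*0≡0 : ∀ x y → x * 0# + y * 0# ≡ 0#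
  x*0+y*0≡0 = solve 2 (λ x y → x :* con 0ℤ :+ y :* con 0ℤ := con 0ℤ) refl

  x*0+y*1≡y : ∀ x y → x * 0# + y * 1# ≡ y
  x*0+y*1≡y = solve 2 (λ x y → x :* con 0ℤ :+ y :* con 1ℤ := y) refl

  x*1+y*0≡x : ∀ x y → x * 1# + y * 0# ≡ x
  x*1+y*0≡x = solve 2 (λ x y → x :* con 1ℤ :+ y :* con 0ℤ := x) refl

  ⟨⟩-cong : ∀ {a0 a1 a2 a3 b0 b1 b2 b3} → a0 ≡ b0 → a1 ≡ b1 → a2 ≡ b2 → a3 ≡ b3 →
            ⟨ a0 , a1 , a2 , a3 ⟩ ≡ ⟨ b0 , b1 , b2 , b3 ⟩
  ⟨⟩-cong refl refl refl refl = refl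

  infixr 7 _·_
  _·_ : Carrier → V4 → V4
  c · p = ⟨ c * c0 p , c * c1 p , c * c2 p , c * c3 p ⟩

  ·-lin : ∀ c a u b v → c · lin a u b v ≡ lin (c * a) u (c * b) v
  ·-lin c a u b v = ⟨⟩-cong (distrib (c0 u) (c0 v)) (distrib (c1 u) (c1 v))
                            (distrib (c2 u) (c2 v)) (distrib (c3 u) (c3 v))
    where
    distrib : ∀ x y → c * (a * x + b * y) ≡ (c * a) * x + (c * b) * y
    distrib = solve 5 (λ c a b x y → c :* (a :* x :+ b :* y) := (c :* a) :* x :+ (c :* b) :* y)
                      refl c a b

  onLine-· : ∀ c {p u v} → OnLine p (u , v) → OnLine (c · p) (u , v)
  onLine-· c {u = u} {v} (a , b , refl) = c * a , c * b , ·-lin c a u b v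

  onLine-multiple⇔ : ∀ {c d p q u v} → c * d ≡ 1# → p ≡ c · q →
                     OnLine p (u , v) ⇔ OnLine q (u , v)
  onLine-multiple⇔ {c} {d} {q = q} c*d≡1 refl = mk⇔ unscale (onLine-· c)
    where
    d·c·q≡q : d · c · q ≡ q
    d·c·q≡q = ⟨⟩-cong (cancel (c0 q)) (cancel (c1 q)) (cancel (c2 q)) (cancel (c3 q))
      where cancel = *-cancel-inverse (trans (*-comm d c) c*d≡1)
    unscale : ∀ {l} → OnLine (c · q) l → OnLine q l
    unscale {u , v} on = subst (λ r → OnLine r (u , v)) d·c·q≡q (onLine-· d on)

  multiple-of-⟨1⟩ : ∀ {p0 d} p1 p2 p3 → p0 * d ≡ 1# →
                    ⟨ p0 , p1 , p2 , p3 ⟩ ≡ p0 · ⟨ 1# , d * p1 , d * p2 , d * p3 ⟩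
  multiple-of-⟨1⟩ {p0} p1 p2 p3 p0*d≡1 =
    ⟨⟩-cong (sym (*-identityʳ p0)) (sym (cancel p1)) (sym (cancel p2)) (sym (cancel p3))
    where cancel = *-cancel-inverse p0*d≡1

  multiple-of-⟨0,1⟩ : ∀ {p1 d} p2 p3 → p1 * d ≡ 1# →
                      ⟨ 0# , p1 , p2 , p3 ⟩ ≡ p1 · ⟨ 0# , 1# , d * p2 , d * p3 ⟩
  multiple-of-⟨0,1⟩ {p1} p2 p3 p1*d≡1 =
    ⟨⟩-cong (sym (zeroʳ p1)) (sym (*-identityʳ p1)) (sym (cancel p2)) (sym (cancel p3))
    where cancel = *-cancel-inverse p1*d≡1

  0*x+0*y≡0 : ∀ x y → 0# * x + 0# * y ≡ 0#
  0*x+0*y≡0 = solve 2 (λ x y → con 0ℤ :* x :+ con 0ℤ :* y := con 0ℤ) refl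

  1*x+0*y≡x : ∀ x y → 1# * x + 0# * y ≡ x
  1*x+0*y≡x = solve 2 (λ x y → con 1ℤ :* x :+ con 0ℤ :* y := x) refl

  x-y+y≡x : ∀ x y → x - y + y ≡ x
  x-y+y≡x = solve 2 (λ x y → x :- y :+ y := x) refl

  form-lin : ∀ α β γ δ u v → form (lin α u β v) (lin γ u δ v) ≡ (α * δ - β * γ) * form u v
  form-lin α β γ δ ⟨ u0 , u1 , u2 , u3 ⟩ ⟨ v0 , v1 , v2 , v3 ⟩ =
    solve 12 (λ α β γ δ u0 u1 u2 u3 v0 v1 v2 v3 →
      let form′ = λ x0 x1 x2 x3 y0 y1 y2 y3 → ((x0 :* y3 :- x3 :* y0) :- x1 :* y2) :+ y1 :* x2 in
      form′ (α :* u0 :+ β :* v0) (α :* u1 :+ β :* v1) (α :* u2 :+ β :* v2) (α :* u3 :+ β :* v3)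
            (γ :* u0 :+ δ :* v0) (γ :* u1 :+ δ :* v1) (γ :* u2 :+ δ :* v2) (γ :* u3 :+ δ :* v3)
      := (α :* δ :- β :* γ) :* form′ u0 u1 u2 u3 v0 v1 v2 v3)
      refl α β γ δ u0 u1 u2 u3 v0 v1 v2 v3

  orthogonal⇒totallyIsotropic : ∀ {u v} → form u v ≡ 0# → TotallyIsotropic (u , v)
  orthogonal⇒totallyIsotropic {u} {v} u⊥v _ _ (α , β , refl) (γ , δ , refl) = begin
    form (lin α u β v) (lin γ u δ v)  ≡⟨ form-lin α β γ δ u v ⟩
    (α * δ - β * γ) * form u v        ≡⟨ cong ((α * δ - β * γ) *_) u⊥v ⟩
    (α * δ - β * γ) * 0#              ≡⟨ zeroʳ _ ⟩
    0#                                ∎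

  module _ (g : Carrier → Carrier → Carrier) where

    S-totallyIsotropic : ∀ i → TotallyIsotropic (S g i)
    S-totallyIsotropic nothing = orthogonal⇒totallyIsotropic
      (solve 0 (((con 0ℤ :* con 0ℤ :- con 1ℤ :* con 0ℤ) :- con 0ℤ :* con 1ℤ) :+ con 0ℤ :* con 0ℤ
                := con 0ℤ) refl)
    S-totallyIsotropic (just (x , y)) = orthogonal⇒totallyIsotropic
      (solve 3 (λ x y G → ((con 0ℤ :* G :- y :* con 1ℤ) :- con 1ℤ :* (:- y)) :+ con 0ℤ :* x := con 0ℤ)
        refl x y (g x y))

    onLine-l∞⇔ : ∀ {p} → OnLine p (S g nothing) ⇔ (c0 p ≡ 0# × c1 p ≡ 0#)
    onLine-l∞⇔ {⟨ p0 , p1 , p2 , p3 ⟩} = mk⇔ to from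
      where
      to : OnLine ⟨ p0 , p1 , p2 , p3 ⟩ (S g nothing) → p0 ≡ 0# × p1 ≡ 0#
      to (a , b , refl) = x*0+y*0≡0 a b , x*0+y*0≡0 a b
      from : p0 ≡ 0# × p1 ≡ 0# → OnLine ⟨ p0 , p1 , p2 , p3 ⟩ (S g nothing)
      from (refl , refl) = p3 , p2 ,
        ⟨⟩-cong (sym (x*0+y*0≡0 p3 p2)) (sym (x*0+y*0≡0 p3 p2))
                (sym (x*0+y*1≡y p3 p2)) (sym (x*1+y*0≡x p3 p2))

    onLine-just⇔ : ∀ {p x y} → OnLine p (S g (just (x , y))) ⇔
                   (c2 p ≡ c1 p * x + c0 p * - y × c3 p ≡ c1 p * y + c0 p * g x y)
    onLine-just⇔ {⟨ p0 , p1 , p2 , p3 ⟩} {x} {y} = mk⇔ to from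
      where
      to : OnLine ⟨ p0 , p1 , p2 , p3 ⟩ (S g (just (x , y))) →
           p2 ≡ p1 * x + p0 * - y × p3 ≡ p1 * y + p0 * g x y
      to (a , b , refl) = coordinate (λ α β → α * x + β * - y) , coordinate (λ α β → α * y + β * g x y)
        where
        coordinate : (h : Carrier → Carrier → Carrier) → h a b ≡ h (a * 1# + b * 0#) (a * 0# + b * 1#)
        coordinate h = sym (cong₂ h (x*1+y*0≡x a b) (x*0+y*1≡y a b))
      from : p2 ≡ p1 * x + p0 * - y × p3 ≡ p1 * y + p0 * g x y →
             OnLine ⟨ p0 , p1 , p2 , p3 ⟩ (S g (just (x , y)))
      from (p2≡ , p3≡) = p1 , p0 , ⟨⟩-cong (sym (x*0+y*1≡y p1 p0)) (sym (x*1+y*0≡x p1 p0)) p2≡ p3≡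

    UniqueLineThrough : V4 → Set
    UniqueLineThrough p = ∃! _≡_ λ i → OnLine p (S g i)

    uniqueLineThrough-multiple : ∀ {c d p q} → c * d ≡ 1# → p ≡ c · q →
                                 UniqueLineThrough q → UniqueLineThrough p
    uniqueLineThrough-multiple c*d≡1 p≡c·q =
      Equivalence.from (∃!-cong λ _ → onLine-multiple⇔ c*d≡1 p≡c·q)

    onLine-⟨0,0⟩⇔ : ∀ {p2 p3} → NonZero ⟨ 0# , 0# , p2 , p3 ⟩ →
                    ∀ i → OnLine ⟨ 0# , 0# , p2 , p3 ⟩ (S g i) ⇔ i ≡ nothing
    onLine-⟨0,0⟩⇔ _ nothing = mk⇔ (λ _ → refl) (λ _ → Equivalence.from onLine-l∞⇔ (refl , refl))
    onLine-⟨0,0⟩⇔ nonZero (just (x , y)) =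
      mk⇔ (λ on → ⊥-elim (nonZero (vanishes (Equivalence.to onLine-just⇔ on)))) λ ()
      where
      vanishes : ∀ {p2 p3} → p2 ≡ 0# * x + 0# * - y × p3 ≡ 0# * y + 0# * g x y →
                 0# ≡ 0# × 0# ≡ 0# × p2 ≡ 0# × p3 ≡ 0#
      vanishes (p2≡ , p3≡) =
        refl , refl , trans p2≡ (0*x+0*y≡0 x (- y)) , trans p3≡ (0*x+0*y≡0 y (g x y))

    onLine-⟨0,1⟩⇔ : ∀ {b e} i → OnLine ⟨ 0# , 1# , b , e ⟩ (S g i) ⇔ i ≡ just (b , e)
    onLine-⟨0,1⟩⇔ nothing =
      mk⇔ (λ on → ⊥-elim (0≢1 (sym (proj₂ (Equivalence.to onLine-l∞⇔ on))))) λ ()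
    onLine-⟨0,1⟩⇔ (just (x , y)) = mk⇔ to from
      where
      to : ∀ {b e} → OnLine ⟨ 0# , 1# , b , e ⟩ (S g (just (x , y))) → just (x , y) ≡ just (b , e)
      to on with b≡ , e≡ ← Equivalence.to onLine-just⇔ on =
        cong just (cong₂ _,_ (sym (trans b≡ (1*x+0*y≡x x (- y)))) (sym (trans e≡ (1*x+0*y≡x y (g x y)))))
      from : ∀ {b e} → just (x , y) ≡ just (b , e) → OnLine ⟨ 0# , 1# , b , e ⟩ (S g (just (x , y)))
      from refl = Equivalence.from onLine-just⇔ (sym (1*x+0*y≡x x (- y)) , sym (1*x+0*y≡x y (g x y)))

    φ : Carrier → Carrier → Carrier → Carrier
    φ a b x = g x (a * x - b) + (a * a) * x

    onLine-just-⟨1⟩⇔ : ∀ {a b e x y} → OnLine ⟨ 1# , a , b , e ⟩ (S g (just (x , y))) ⇔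
                       (y ≡ a * x - b × φ a b x ≡ e + a * b)
    onLine-just-⟨1⟩⇔ {a} {b} {e} {x} {y} = mk⇔ to from
      where
      to : OnLine ⟨ 1# , a , b , e ⟩ (S g (just (x , y))) → y ≡ a * x - b × φ a b x ≡ e + a * b
      to on with b≡ , e≡ ← Equivalence.to onLine-just⇔ on = y≡ , φ≡
        where
        y≡ : y ≡ a * x - b
        y≡ = begin
          y                           ≡⟨ solve 3 (λ a x y → y := a :* x :- (a :* x :+ con 1ℤ :* (:- y)))
                                                 refl a x y ⟩
          a * x - (a * x + 1# * - y)  ≡⟨ cong (λ z → a * x - z) b≡ ⟨
          a * x - b                   ∎
        φ≡ : φ a b x ≡ e + a * b
        φ≡ = begin
          g x (a * x - b) + a * a * x               ≡⟨ cong (λ z → g x z + a * a * x) y≡ ⟨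
          g x y + a * a * x                         ≡⟨ solve 4 (λ a b x G → G :+ a :* a :* x
                                                               := a :* (a :* x :- b) :+ con 1ℤ :* G :+ a :* b)
                                                               refl a b x (g x y) ⟩
          a * (a * x - b) + 1# * g x y + a * b      ≡⟨ cong (λ z → a * z + 1# * g x y + a * b) y≡ ⟨
          a * y + 1# * g x y + a * b                ≡⟨ cong (_+ a * b) e≡ ⟨
          e + a * b                                 ∎
      from : y ≡ a * x - b × φ a b x ≡ e + a * b → OnLine ⟨ 1# , a , b , e ⟩ (S g (just (x , y)))
      from (refl , φ≡) = Equivalence.from onLine-just⇔ (b≡ , e≡)
        where
        b≡ : b ≡ a * x + 1# * - (a * x - b)
        b≡ = solve 3 (λ a b x → b := a :* x :+ con 1ℤ :* (:- (a :* x :- b))) refl a b x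
        e≡ : e ≡ a * (a * x - b) + 1# * g x (a * x - b)
        e≡ = begin
          e                                    ≡⟨ solve 3 (λ e a b → e := e :+ a :* b :- a :* b) refl e a b ⟩
          e + a * b - a * b                    ≡⟨ cong (_- a * b) φ≡ ⟨
          φ a b x - a * b                      ≡⟨ solve 4 (λ a b x G → G :+ a :* a :* x :- a :* b
                                                          := a :* (a :* x :- b) :+ con 1ℤ :* G)
                                                          refl a b x (g x (a * x - b)) ⟩
          a * (a * x - b) + 1# * g x (a * x - b) ∎

    onLine-⟨1⟩⇔ : ∀ {a b e} i → OnLine ⟨ 1# , a , b , e ⟩ (S g i) ⇔
                  ∃ λ x → i ≡ just (x , a * x - b) × φ a b x ≡ e + a * b
    onLine-⟨1⟩⇔ nothing =
      mk⇔ (λ on → ⊥-elim (0≢1 (sym (proj₁ (Equivalence.to onLine-l∞⇔ on))))) λ { (_ , () , _) }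
    onLine-⟨1⟩⇔ (just (x , y)) = mk⇔ to from
      where
      to : ∀ {a b e} → OnLine ⟨ 1# , a , b , e ⟩ (S g (just (x , y))) →
           ∃ λ x′ → just (x , y) ≡ just (x′ , a * x′ - b) × φ a b x′ ≡ e + a * b
      to on with y≡ , φ≡ ← Equivalence.to onLine-just-⟨1⟩⇔ on =
        x , cong (λ z → just (x , z)) y≡ , φ≡
      from : ∀ {a b e} → (∃ λ x′ → just (x , y) ≡ just (x′ , a * x′ - b) × φ a b x′ ≡ e + a * b) →
             OnLine ⟨ 1# , a , b , e ⟩ (S g (just (x , y)))
      from (_ , refl , φ≡) = Equivalence.from onLine-just-⟨1⟩⇔ (refl , φ≡)

    uniqueLineThrough-⟨1⟩⇔ : ∀ a b e →
      UniqueLineThrough ⟨ 1# , a , b , e ⟩ ⇔ ∃! _≡_ (λ x → φ a b x ≡ e + a * b)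
    uniqueLineThrough-⟨1⟩⇔ a b e = ∃!-image graph graph-injective ⇔-∘ ∃!-cong onLine-⟨1⟩⇔
      where
      graph : Carrier → Maybe (Carrier × Carrier)
      graph x = just (x , a * x - b)
      graph-injective : Injective _≡_ _≡_ graph
      graph-injective = ,-injectiveˡ ∘ just-injective

    spread-of-perm : PermCondition g → IsSpread (S g)
    spread-of-perm perm ⟨ p0 , p1 , p2 , p3 ⟩ nonZero with p0 ≟ 0#
    ... | no p0≢0 with d , p0*d≡1 ← inverse p0 p0≢0 =
      uniqueLineThrough-multiple p0*d≡1 (multiple-of-⟨1⟩ p1 p2 p3 p0*d≡1)
        (Equivalence.from (uniqueLineThrough-⟨1⟩⇔ a b e)
          (Equivalence.to (bijective⇔∃!-preimage (φ a b)) (perm a b) (e + a * b)))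
      where a = d * p1; b = d * p2; e = d * p3
    ... | yes refl with p1 ≟ 0#
    ...   | yes refl = Equivalence.from (∃!-cong (onLine-⟨0,0⟩⇔ nonZero)) (∃!-≡ nothing)
    ...   | no p1≢0 with d , p1*d≡1 ← inverse p1 p1≢0 =
      uniqueLineThrough-multiple p1*d≡1 (multiple-of-⟨0,1⟩ p2 p3 p1*d≡1)
        (Equivalence.from (∃!-cong onLine-⟨0,1⟩⇔) (∃!-≡ _))

    perm-of-spread : IsSpread (S g) → PermCondition g
    perm-of-spread spread a b = Equivalence.from (bijective⇔∃!-preimage (φ a b)) λ t →
      subst (λ t′ → ∃! _≡_ λ x → φ a b x ≡ t′) (x-y+y≡x t (a * b))
        (Equivalence.to (uniqueLineThrough-⟨1⟩⇔ a b (t - a * b))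
          (spread ⟨ 1# , a , b , t - a * b ⟩ λ (0≡1 , _) → 0≢1 (sym 0≡1)))

open FiniteField using (Carrier)
open ProjectiveSpace using (IsSpread; IsSymplecticSpread; S; PermCondition)

theorem1 : (𝔽 : FiniteField) (g : Carrier 𝔽 → Carrier 𝔽 → Carrier 𝔽) →
    (IsSpread 𝔽 (S 𝔽 g) ⇔ PermCondition 𝔽 g)
    × (IsSymplecticSpread 𝔽 (S 𝔽 g) ⇔ PermCondition 𝔽 g)
theorem1 𝔽 g =
  mk⇔ (perm-of-spread 𝔽 g) (spread-of-perm 𝔽 g) ,
  mk⇔ (perm-of-spread 𝔽 g ∘ proj₁) (λ perm → spread-of-perm 𝔽 g perm , S-totallyIsotropic 𝔽 g)
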